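{- Let $n\ge1$ and assume $(b,a)$ is $n$-good with $s(n)=s$. Then: (a) $a\le b$; (b) a pair $(b',a')$ with $a',b'\ge1$ is $n$-good if and only if $a'=a+kf_{s-2}$ and $b'=b-kf_{s-1}$ for some $k\in\mathbb Z$; (c) for such $k$, $w_{s+1}(b,a)-w_{s+1}(b',a')=(-1)^sk$.
   Context: $f_k$ are the Fibonacci numbers, $f_1=f_2=1$, $f_{k+2}=f_{k+1}+f_k$, with $f_0=0$, $f_{ -1}=1$. For positive integers $a_1,a_2$, $w_k=w_k(a_1,a_2)$ is the sequence with $w_1=a_1$, $w_2=a_2$, $w_{k+2}=w_{k+1}+w_k$. Let $s(n;a_1,a_2)$ be the integer $s$ with $w_s(a_1,a_2)=n$ ($-\infty$ if none), and $s(n)=\max_{a_1,a_2\ge1}s(n;a_1,a_2)$. A pair $(a_1,a_2)$ is $n$-good if $a_1,a_2\ge1$ and $s(n;a_1,a_2)=s(n)$. -}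

module Defs where

open import Data.Nat using (ℕ; zero; suc; _+_; _≤_)
open import Data.Product using (Σ; ∃; _×_; _,_)
open import Relation.Binary.PropositionalEquality using (_≡_)

fib : ℕ → ℕ
fib zero = 0
fib (suc zero) = 1
fib (suc (suc k)) = fib (suc k) + fib k

-- go a₁ a₂ k = w_{k+1}(a₁,a₂)
go : ℕ → ℕ → ℕ → ℕ
go a b zero = a
go a b (suc k) = go b (a + b) k

-- w t a₁ a₂ = w_t(a₁,a₂) for t ≥ 1 (w_1 = a₁, w_2 = a₂, w_{k+2} = w_{k+1} + w_k).
-- The value at t = 0 is junk and is never used (all uses require t ≥ 1).
w : ℕ → ℕ → ℕ → ℕ
w zero a b = 0
w (suc k) a b = go a b k

SOf : ℕ → ℕ → ℕ → ℕ → Set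
SOf n a₁ a₂ t = (1 ≤ t) × (w t a₁ a₂ ≡ n) × (∀ t' → 1 ≤ t' → w t' a₁ a₂ ≡ n → t' ≤ t)

SMax : ℕ → ℕ → Set
SMax n s = (Σ ℕ λ a₁ → Σ ℕ λ a₂ → (1 ≤ a₁) × (1 ≤ a₂) × SOf n a₁ a₂ s)
         × (∀ a₁ a₂ t → 1 ≤ a₁ → 1 ≤ a₂ → SOf n a₁ a₂ t → t ≤ s)

Good : ℕ → ℕ → ℕ → Set
Good n a₁ a₂ = (1 ≤ a₁) × (1 ≤ a₂) × (∃ λ s → SMax n s × SOf n a₁ a₂ s)

-- Write P = f_m, Q = f_{m+1}.  Every sequence satisfies w_{m+2}(b,a) = P b + Q a, and a sequence
-- with positive seeds is strictly increasing from its second term on, so it takes the value n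
-- there at most once.  The pair (1,n) shows s(n) ≥ 2, so for s = s(n) = m + 2 the n-good pairs
-- are exactly the positive solutions of P b' + Q a' = n.  Consecutive Fibonacci numbers satisfy
-- a Bézout identity, so these solutions are the shifts (b - kQ, a + kP) of one of them, and
-- Cassini's identity Q² - f_{m+2} P = (-1)^s turns the shift into the difference of the next
-- terms.  Finally an n-good (b,a) with a > b is impossible: (a - b, b) would reach n one step later.
module Submission where

open import Defs
open import Data.Nat using (ℕ; _≤_; _∸_; suc)
open import Data.Integer using (ℤ; +_; -_; _+_; _-_; _*_; _^_)
open import Data.Product using (Σ; ∃; _×_; _,_)
open import Function.Bundles using (_⇔_)
open import Relation.Binary.PropositionalEquality using (_≡_)

open import Data.Nat as ℕ using (zero; z≤n; s≤s; _<_; _<′_; ≤′-refl; ≤′-step; _≤?_)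
open import Data.Nat.Properties
  using (≤-trans; <-trans; ≤-antisym; <⇒≤; m≤m+n; m<n+m; <⇒≢; ≰⇒>; <⇒<′; 1+n≰n; m<n⇒0<n∸m; m∸n+n≡m)
open import Data.Integer using (0ℤ; 1ℤ)
open import Data.Integer.Properties using (+-injective)
open import Data.Integer.Tactic.RingSolver using (solve-∀)
open import Data.Product using (∃₂)
open import Function.Bundles using (mk⇔)
import Function.Properties.Equivalence as ⇔
open import Relation.Nullary using (yes; no; contradiction)
open import Relation.Binary.PropositionalEquality using (refl; sym; trans; cong; cong₂; module ≡-Reasoning)

fibℤ : ℕ → ℤ
fibℤ m = + fib m

go-fib : ∀ m a b → + go a b (suc m) ≡ fibℤ m * + a + fibℤ (suc m) * + b
go-fib zero a b = second-seed (+ a) (+ b)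
  where
  second-seed : ∀ (A B : ℤ) → B ≡ 0ℤ * A + 1ℤ * B
  second-seed = solve-∀
go-fib (suc m) a b = begin
  + go b (a ℕ.+ b) (suc m)                          ≡⟨ go-fib m b (a ℕ.+ b) ⟩
  P * + b + Q * (+ a + + b)                         ≡⟨ regroup P Q (+ a) (+ b) ⟩
  Q * + a + (Q + P) * + b                           ∎
  where
  open ≡-Reasoning
  P = fibℤ m
  Q = fibℤ (suc m)
  regroup : ∀ (P Q A B : ℤ) → P * B + Q * (A + B) ≡ Q * A + (Q + P) * B
  regroup = solve-∀

fib-bezout : ∀ m → ∃₂ λ u v → u * fibℤ m + v * fibℤ (suc m) ≡ 1ℤ
fib-bezout zero = 0ℤ , 1ℤ , refl
fib-bezout (suc m) with fib-bezout m
... | u , v , uP+vQ≡1 = v - u , u , trans (regroup u v (fibℤ m) (fibℤ (suc m))) uP+vQ≡1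
  where
  regroup : ∀ (u v P Q : ℤ) → (v - u) * Q + u * (Q + P) ≡ u * P + v * Q
  regroup = solve-∀

fib-cassini : ∀ m → fibℤ (suc m) * fibℤ (suc m) - fibℤ (suc (suc m)) * fibℤ m ≡ (- 1ℤ) ^ suc (suc m)
fib-cassini zero = refl
fib-cassini (suc m) = begin
  R * R - (R + Q) * Q           ≡⟨ cassini-step P Q ⟩
  - 1ℤ * (Q * Q - R * P)        ≡⟨ cong (- 1ℤ *_) (fib-cassini m) ⟩
  (- 1ℤ) ^ suc (suc (suc m))    ∎
  where
  open ≡-Reasoning
  P = fibℤ m
  Q = fibℤ (suc m)
  R = fibℤ (suc (suc m))
  cassini-step : ∀ (P Q : ℤ) → (Q + P) * (Q + P) - ((Q + P) + Q) * Q ≡ - 1ℤ * (Q * Q - (Q + P) * P)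
  cassini-step = solve-∀

-- With u P + v Q = 1, the shift k := u (A′ - A) - v (B′ - B) works because P (B′ - B) = -Q (A′ - A).
linear-level-set : ∀ {P Q u v : ℤ} → u * P + v * Q ≡ 1ℤ → ∀ A B A′ B′ →
  (P * B′ + Q * A′ ≡ P * B + Q * A) ⇔ (∃ λ k → (A′ ≡ A + k * P) × (B′ ≡ B - k * Q))
linear-level-set {P} {Q} {u} {v} uP+vQ≡1 A B A′ B′ = mk⇔ to from
  where
  open ≡-Reasoning
  to : P * B′ + Q * A′ ≡ P * B + Q * A → ∃ λ k → (A′ ≡ A + k * P) × (B′ ≡ B - k * Q)
  to level = k , sym shiftA , sym shiftB
    where
    k = u * (A′ - A) - v * (B′ - B)
    L = P * B + Q * A
    L′ = P * B′ + Q * A′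
    expandA : ∀ (A A′ B B′ P Q u v : ℤ) → A + (u * (A′ - A) - v * (B′ - B)) * P
      ≡ A′ + (A′ - A) * (u * P + v * Q - 1ℤ) + v * ((P * B + Q * A) - (P * B′ + Q * A′))
    expandA = solve-∀
    expandB : ∀ (A A′ B B′ P Q u v : ℤ) → B - (u * (A′ - A) - v * (B′ - B)) * Q
      ≡ B′ + (B′ - B) * (u * P + v * Q - 1ℤ) + u * ((P * B + Q * A) - (P * B′ + Q * A′))
    expandB = solve-∀
    collapse : ∀ (X X′ c Y : ℤ) → X′ + (X′ - X) * (1ℤ - 1ℤ) + c * (Y - Y) ≡ X′
    collapse = solve-∀
    shiftA : A + k * P ≡ A′
    shiftA = begin
      A + k * P
        ≡⟨ expandA A A′ B B′ P Q u v ⟩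
      A′ + (A′ - A) * (u * P + v * Q - 1ℤ) + v * (L - L′)
        ≡⟨ cong₂ (λ d l → A′ + (A′ - A) * (d - 1ℤ) + v * (l - L′)) uP+vQ≡1 (sym level) ⟩
      A′ + (A′ - A) * (1ℤ - 1ℤ) + v * (L′ - L′)
        ≡⟨ collapse A A′ v L′ ⟩
      A′ ∎
    shiftB : B - k * Q ≡ B′
    shiftB = begin
      B - k * Q
        ≡⟨ expandB A A′ B B′ P Q u v ⟩
      B′ + (B′ - B) * (u * P + v * Q - 1ℤ) + u * (L - L′)
        ≡⟨ cong₂ (λ d l → B′ + (B′ - B) * (d - 1ℤ) + u * (l - L′)) uP+vQ≡1 (sym level) ⟩
      B′ + (B′ - B) * (1ℤ - 1ℤ) + u * (L′ - L′)
        ≡⟨ collapse B B′ u L′ ⟩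
      B′ ∎
  from : (∃ λ k → (A′ ≡ A + k * P) × (B′ ≡ B - k * Q)) → P * B′ + Q * A′ ≡ P * B + Q * A
  from (k , refl , refl) = shift-invariant A B P Q k
    where
    shift-invariant : ∀ (A B P Q k : ℤ) → P * (B - k * Q) + Q * (A + k * P) ≡ P * B + Q * A
    shift-invariant = solve-∀

go-step : ∀ {a b} → 1 ≤ a → 1 ≤ b → ∀ j → go a b (suc j) < go a b (suc (suc j))
go-step {a} {b} 1≤a 1≤b zero = m<n+m b 1≤a
go-step {a} {b} 1≤a 1≤b (suc j) = go-step 1≤b (≤-trans 1≤a (m≤m+n a b)) j

go-strictMono : ∀ {a b i j} → 1 ≤ a → 1 ≤ b → i <′ j → go a b (suc i) < go a b (suc j)
go-strictMono {i = i} 1≤a 1≤b ≤′-refl = go-step 1≤a 1≤b i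
go-strictMono {j = suc j} 1≤a 1≤b (≤′-step i<′j) = <-trans (go-strictMono 1≤a 1≤b i<′j) (go-step 1≤a 1≤b j)

sOf-reach : ∀ {n a b} m → 1 ≤ a → 1 ≤ b → go a b (suc m) ≡ n → SOf n a b (suc (suc m))
sOf-reach {n} {a} {b} m 1≤a 1≤b reach = s≤s z≤n , reach , maximal
  where
  maximal : ∀ t → 1 ≤ t → w t a b ≡ n → t ≤ suc (suc m)
  maximal t _ reach′ with t ≤? suc (suc m)
  ... | yes t≤ = t≤
  ... | no t≰ with ≰⇒> t≰
  ... | s≤s (s≤s (s≤s m≤t)) =
    contradiction (trans reach (sym reach′)) (<⇒≢ (go-strictMono 1≤a 1≤b (<⇒<′ (s≤s m≤t))))

sMax-unique : ∀ {n s s′} → SMax n s → SMax n s′ → s ≡ s′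
sMax-unique ((a₁ , a₂ , 1≤a₁ , 1≤a₂ , sOf) , bound) ((a₁′ , a₂′ , 1≤a₁′ , 1≤a₂′ , sOf′) , bound′) =
  ≤-antisym (bound′ a₁ a₂ _ 1≤a₁ 1≤a₂ sOf) (bound a₁′ a₂′ _ 1≤a₁′ 1≤a₂′ sOf′)

sMax-≥2 : ∀ {n s} → 1 ≤ n → SMax n s → 2 ≤ s
sMax-≥2 {n} 1≤n (_ , bound) = bound 1 n 2 (s≤s z≤n) 1≤n (sOf-reach 0 (s≤s z≤n) 1≤n refl)

sMax-seed-≤ : ∀ {n a b s} → 1 ≤ b → SMax n s → SOf n b a s → a ≤ b
sMax-seed-≤ {n} {a} {b} {suc s} 1≤b (_ , bound) (_ , reach , _) with a ≤? b
... | yes a≤b = a≤b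
... | no a≰b = contradiction (bound (a ∸ b) b (suc (suc s)) (m<n⇒0<n∸m b<a) 1≤b earlier) 1+n≰n
  where
  b<a = ≰⇒> a≰b
  earlier : SOf n (a ∸ b) b (suc (suc s))
  earlier = sOf-reach s (m<n⇒0<n∸m b<a) 1≤b (trans (cong (λ c → go b c s) (m∸n+n≡m (<⇒≤ b<a))) reach)

good⇔reach : ∀ {n m b a} → SMax n (suc (suc m)) → 1 ≤ b → 1 ≤ a → Good n b a ⇔ (go b a (suc m) ≡ n)
good⇔reach {n} {m} {b} {a} sMax 1≤b 1≤a = mk⇔ to (λ reach → 1≤b , 1≤a , _ , sMax , sOf-reach _ 1≤b 1≤a reach)
  where
  to : Good n b a → go b a (suc m) ≡ n
  to (_ , _ , _ , sMax′ , (_ , reach , _)) with sMax-unique sMax′ sMax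
  ... | refl = reach

reach⇔fib-level : ∀ {n b a b′ a′} m → go b a (suc m) ≡ n →
  (go b′ a′ (suc m) ≡ n) ⇔ (fibℤ m * + b′ + fibℤ (suc m) * + a′ ≡ fibℤ m * + b + fibℤ (suc m) * + a)
reach⇔fib-level {b = b} {a} {b′} {a′} m reach = mk⇔
  (λ reach′ → trans (sym (go-fib m b′ a′)) (trans (cong +_ (trans reach′ (sym reach))) (go-fib m b a)))
  (λ level → trans (+-injective (trans (go-fib m b′ a′) (trans level (sym (go-fib m b a))))) reach)

good⇔fib-shift : ∀ {n m b a} → SMax n (suc (suc m)) → go b a (suc m) ≡ n → ∀ b′ a′ → 1 ≤ b′ → 1 ≤ a′ →
  Good n b′ a′ ⇔ (∃ λ k → (+ a′ ≡ + a + k * fibℤ m) × (+ b′ ≡ + b - k * fibℤ (suc m)))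
good⇔fib-shift {m = m} {b} {a} sMax reach b′ a′ 1≤b′ 1≤a′ with fib-bezout m
... | u , v , bezout = ⇔.trans (good⇔reach sMax 1≤b′ 1≤a′)
  (⇔.trans (reach⇔fib-level m reach) (linear-level-set {u = u} {v} bezout (+ a) (+ b) (+ a′) (+ b′)))

fib-shift-next-difference : ∀ m {b a b′ a′} k →
  + a′ ≡ + a + k * fibℤ m → + b′ ≡ + b - k * fibℤ (suc m) →
  + go b a (suc (suc m)) - + go b′ a′ (suc (suc m)) ≡ (- 1ℤ) ^ suc (suc m) * k
fib-shift-next-difference m {b} {a} {b′} {a′} k a′≡ b′≡ = begin
  + go b a (suc (suc m)) - + go b′ a′ (suc (suc m))
    ≡⟨ cong₂ _-_ (go-fib (suc m) b a) (go-fib (suc m) b′ a′) ⟩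
  (Q * + b + R * + a) - (Q * + b′ + R * + a′)
    ≡⟨ cong₂ (λ y x → (Q * + b + R * + a) - (Q * y + R * x)) b′≡ a′≡ ⟩
  (Q * + b + R * + a) - (Q * (+ b - k * Q) + R * (+ a + k * P))
    ≡⟨ difference P Q (+ a) (+ b) k ⟩
  (Q * Q - R * P) * k
    ≡⟨ cong (_* k) (fib-cassini m) ⟩
  (- 1ℤ) ^ suc (suc m) * k ∎
  where
  open ≡-Reasoning
  P = fibℤ m
  Q = fibℤ (suc m)
  R = fibℤ (suc (suc m))
  difference : ∀ (P Q A B k : ℤ) →
    (Q * B + (Q + P) * A) - (Q * (B - k * Q) + (Q + P) * (A + k * P)) ≡ (Q * Q - (Q + P) * P) * k
  difference = solve-∀

lemma9 : (n b a s : ℕ) → 1 ≤ n → Good n b a → SMax n s →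
    (a ≤ b)
    × (∀ b' a' → 1 ≤ b' → 1 ≤ a' →
    Good n b' a' ⇔ (∃ λ (k : ℤ) → (+ a' ≡ + a + k * + fib (s ∸ 2)) × (+ b' ≡ + b - k * + fib (s ∸ 1))))
    × (∀ b' a' (k : ℤ) → 1 ≤ b' → 1 ≤ a' →
    + a' ≡ + a + k * + fib (s ∸ 2) → + b' ≡ + b - k * + fib (s ∸ 1) →
    + w (suc s) b a - + w (suc s) b' a' ≡ (- (+ 1)) ^ s * k)
lemma9 n b a s 1≤n (1≤b , 1≤a , _ , sMax′ , sOf@(_ , reach , _)) sMax
  with sMax-unique sMax′ sMax | sMax-≥2 1≤n sMax
... | refl | s≤s (s≤s {n = m} _) =
  sMax-seed-≤ 1≤b sMax sOf ,
  good⇔fib-shift sMax reach ,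
  λ b′ a′ k _ _ → fib-shift-next-difference m k
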